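{- Let $n$ be a positive integer, let $\ell$ be an integer with $1 \le \ell \le n-2$, and let $t \in \mathbb{Z}_n$. If $A$ is an $\ell$-subset of $\mathbb{Z}_n \setminus \{0\}$ chosen uniformly at random, then the probability that $\sum_{a \in A} a = t$ (in $\mathbb{Z}_n$) is at most $2/n$. -}

module Defs where

open import Data.Nat using (ℕ; zero; suc; NonZero; _≟_)
open import Data.Nat.DivMod using (_%_)
open import Data.Fin using (Fin; toℕ) renaming (zero to fzero)
open import Data.Fin.Subset using (Subset; inside; outside; ∣_∣)
open import Data.Fin.Subset.Properties using (_∈?_)
open import Data.List using (List; []; _∷_; map; _++_; filter; length; allFin)
open import Data.Nat.ListAction using (sum)
open import Data.Vec using (_∷_; [])
open import Relation.Nullary using (Dec; ¬?; ¬_)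
open import Data.Product using (_×_)
open import Relation.Binary.PropositionalEquality using (_≡_)
open import Data.Fin.Subset using (_∈_)
open import Relation.Nullary.Decidable using (_×-dec_)

-- All subsets of Fin n (= Z_n), listed without repetition.
subsets : ∀ n → List (Subset n)
subsets zero = [] ∷ []
subsets (suc n) = map (outside ∷_) (subsets n) ++ map (inside ∷_) (subsets n)

elemSum : ∀ {n} → Subset n → ℕ
elemSum {n} A = sum (map toℕ (filter (_∈? A) (allFin n)))

zeroF : ∀ n .{{_ : NonZero n}} → Fin n
zeroF (suc m) = fzero

isLSubset : ∀ n .{{_ : NonZero n}} (ℓ : ℕ) (A : Subset n) → Dec (¬ (zeroF n ∈ A) × ∣ A ∣ ≡ ℓ)
isLSubset n ℓ A = ¬? (zeroF n ∈? A) ×-dec (∣ A ∣ ≟ ℓ)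

-- The number of ℓ-subsets of Z_n \ {0}  (sample space size).
total : ∀ n .{{_ : NonZero n}} (ℓ : ℕ) → ℕ
total n ℓ = length (filter (isLSubset n ℓ) (subsets n))

good : ∀ n .{{_ : NonZero n}} (ℓ : ℕ) (t : Fin n) → ℕ
good n ℓ t = length (filter (λ A → isLSubset n ℓ A ×-dec (elemSum A % n ≟ toℕ t)) (subsets n))

-- Let T ℓ count the ℓ-subsets of ℤₙ ∖ {0} and N ℓ the good ones, those with sum t.
-- Double count the pairs (B, x) with x ∉ B and B ∪ {x} good of size ℓ: as B ∪ {x}
-- has sum ΣB + x, each B admits at most one such x, so ℓ N ℓ ≤ T (ℓ − 1).
-- Dually, every (ℓ + 1)-set A has at most one x ∈ A with Σ(A ∖ {x}) = t, so
-- (n − 1 − ℓ) N ℓ ≤ T (ℓ + 1). The same double counting without the sum condition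
-- gives ℓ T ℓ = (n − ℓ) T (ℓ − 1) and (ℓ + 1) T (ℓ + 1) = (n − 1 − ℓ) T ℓ, hence
-- (n − ℓ) N ℓ ≤ T ℓ and (ℓ + 1) N ℓ ≤ T ℓ (the latter needs ℓ ≤ n − 2), and adding
-- them gives (n + 1) N ℓ ≤ 2 T ℓ.

module Submission where

open import Defs

open import Algebra.Bundles using (CommutativeMonoid)
open import Data.Bool using (Bool; true; false; not; _∧_; T)
open import Data.Bool.Properties using (T-≡; T-∧; T-not-≡; ∧-commutativeMonoid)
open import Data.Fin using (Fin; zero; suc; toℕ)
open import Data.Fin.Properties using (toℕ-injective; toℕ<n; suc-injective)
open import Data.Fin.Subset using (Subset; inside; outside; ∣_∣; ∁)
open import Data.Fin.Subset.Properties using (_∈?_; ∣∁p∣≡n∸∣p∣)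
open import Data.List using ([]; _∷_; _++_; map; filter; length; allFin; tabulate)
open import Data.List.Properties using (map-++; map-∘; map-tabulate)
open import Data.Nat using (ℕ; zero; suc; NonZero; >-nonZero; _+_; _*_; _∸_; _≤_; _<_; _≡ᵇ_; z≤n; s≤s)
open import Data.Nat.DivMod using (_%_; _/_; m≡m%n+[m/n]*n; %-distribˡ-+)
open import Data.Nat.Divisibility using (_∣_; ∣m+n∣m⇒∣n; n∣m*n; >⇒∤)
open import Data.Nat.ListAction using (sum)
open import Data.Nat.ListAction.Properties using (sum-++)
open import Data.Nat.Properties
  using ( +-*-semiring; +-commutativeSemigroup; *-commutativeSemigroup; module ≤-Reasoning
        ; ≡ᵇ⇒≡; ≤-reflexive; ≤-trans; ≤-total; ≤-<-trans; <⇒≤; <-trans; n≤1+n; n<1+n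
        ; +-comm; +-assoc; +-identityʳ; +-cancelˡ-≡; +-mono-≤
        ; *-comm; *-assoc; *-identityˡ; *-zeroʳ; *-distribˡ-+; *-distribʳ-+
        ; *-monoˡ-≤; *-monoʳ-≤; *-cancelˡ-≤; m∸n≤m; m+[n∸m]≡n; m<n⇒0<n∸m)
open import Data.Product using (_,_; proj₂)
open import Data.Sum using (inj₁; inj₂)
open import Data.Vec using (_∷_; []; lookup; _[_]≔_)
open import Data.Vec.Properties using (lookup-map; lookup∘update; []≔-idempotent; []≔-lookup)
open import Function using (_∘_; id; Equivalence)
open import Relation.Binary.PropositionalEquality
open import Relation.Nullary using (does; contradiction)
open import Relation.Unary using (Pred; Decidable)

open import Algebra.Properties.Semiring.Sum +-*-semiring
  using (sum-syntax; sum-cong-≗; sum-replicate-zero; *-distribˡ-sum; *-distribʳ-sum)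
  renaming (sum to ∑)
open import Algebra.Properties.CommutativeSemigroup +-commutativeSemigroup
  using (interchange) renaming (x∙yz≈y∙xz to m+[n+o]≡n+[m+o])
open import Algebra.Properties.CommutativeSemigroup *-commutativeSemigroup
  using () renaming (x∙yz≈y∙xz to m*[n*o]≡n*[m*o]; xy∙z≈y∙xz to m*n*o≡n*[m*o])
open import Algebra.Properties.CommutativeSemigroup (CommutativeMonoid.commutativeSemigroup ∧-commutativeMonoid)
  using (xy∙z≈y∙xz)

open Equivalence using (to; from)

⟦_⟧ : Bool → ℕ
⟦ true ⟧ = 1
⟦ false ⟧ = 0

⟦∧⟧ : ∀ a b → ⟦ a ∧ b ⟧ ≡ ⟦ a ⟧ * ⟦ b ⟧
⟦∧⟧ true b = sym (+-identityʳ ⟦ b ⟧)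
⟦∧⟧ false b = refl

∑-zero : ∀ {n} (f : Fin n → ℕ) → (∀ x → f x ≡ 0) → ∑[ x < n ] f x ≡ 0
∑-zero {n} f f≗0 = trans (sum-cong-≗ f≗0) (sum-replicate-zero n)

∑⟦⟧≤1 : ∀ {n} (p : Fin n → Bool) → (∀ {x y} → T (p x) → T (p y) → x ≡ y) → ∑[ x < n ] ⟦ p x ⟧ ≤ 1
∑⟦⟧≤1 {zero} p unique = z≤n
∑⟦⟧≤1 {suc n} p unique with p zero in p0
... | false = ∑⟦⟧≤1 (p ∘ suc) (λ px py → suc-injective (unique px py))
... | true = ≤-reflexive (cong suc (∑-zero (λ x → ⟦ p (suc x) ⟧) rest≡0))
  where
  rest≡0 : ∀ x → ⟦ p (suc x) ⟧ ≡ 0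
  rest≡0 x with p (suc x) in px
  ... | false = refl
  ... | true with () ← unique (from T-≡ p0) (from T-≡ px)

∑∈-syntax : ∀ {n} → Subset n → (Fin n → ℕ) → ℕ
∑∈-syntax A f = ∑ (λ x → ⟦ lookup A x ⟧ * f x)

∑∉-syntax : ∀ {n} → Subset n → (Fin n → ℕ) → ℕ
∑∉-syntax A f = ∑ (λ x → ⟦ not (lookup A x) ⟧ * f x)

syntax ∑∈-syntax A (λ x → e) = ∑[ x ∈ A ] e
syntax ∑∉-syntax A (λ x → e) = ∑[ x ∉ A ] e

∑∈-const : ∀ {n} (A : Subset n) c → ∑[ x ∈ A ] c ≡ ∣ A ∣ * c
∑∈-const [] c = refl
∑∈-const (outside ∷ A) c = ∑∈-const A c
∑∈-const (inside ∷ A) c = cong₂ _+_ (*-identityˡ c) (∑∈-const A c)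

∑∉-const : ∀ {n} (A : Subset n) c → ∑[ x ∉ A ] c ≡ (n ∸ ∣ A ∣) * c
∑∉-const {n} A c = begin
  ∑[ x ∉ A ] c                ≡⟨ sum-cong-≗ (λ x → cong (λ b → ⟦ b ⟧ * c) (sym (lookup-map x not A))) ⟩
  ∑[ x ∈ ∁ A ] c              ≡⟨ ∑∈-const (∁ A) c ⟩
  ∣ ∁ A ∣ * c                 ≡⟨ cong (_* c) (∣∁p∣≡n∸∣p∣ A) ⟩
  (n ∸ ∣ A ∣) * c             ∎
  where open ≡-Reasoning

∑∈-insert : ∀ {n} (A : Subset n) {x} (f : Fin n → ℕ) → lookup A x ≡ outside →
            ∑[ y ∈ A [ x ]≔ inside ] f y ≡ f x + ∑[ y ∈ A ] f y
∑∈-insert (outside ∷ A) {zero} f refl = cong (_+ ∑[ y ∈ A ] f (suc y)) (*-identityˡ (f zero))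
∑∈-insert (b ∷ A) {suc x} f x∉A = begin
  ⟦ b ⟧ * f zero + ∑[ y ∈ A [ x ]≔ inside ] f (suc y)    ≡⟨ cong (⟦ b ⟧ * f zero +_) (∑∈-insert A (f ∘ suc) x∉A) ⟩
  ⟦ b ⟧ * f zero + (f (suc x) + ∑[ y ∈ A ] f (suc y))    ≡⟨ m+[n+o]≡n+[m+o] (⟦ b ⟧ * f zero) (f (suc x)) _ ⟩
  f (suc x) + (⟦ b ⟧ * f zero + ∑[ y ∈ A ] f (suc y))    ∎
  where open ≡-Reasoning

∣insert∣ : ∀ {n} (A : Subset n) {x} → lookup A x ≡ outside → ∣ A [ x ]≔ inside ∣ ≡ suc ∣ A ∣
∣insert∣ (outside ∷ A) {zero} refl = refl
∣insert∣ (outside ∷ A) {suc x} x∉A = ∣insert∣ A x∉A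
∣insert∣ (inside ∷ A) {suc x} x∉A = cong suc (∣insert∣ A x∉A)

update-restore : ∀ {n} (A : Subset n) {x b} c → lookup A x ≡ b → (A [ x ]≔ c) [ x ]≔ b ≡ A
update-restore A {x} c refl = trans ([]≔-idempotent A x) ([]≔-lookup A x)

∑Subset : ∀ n → (Subset n → ℕ) → ℕ
∑Subset zero f = f []
∑Subset (suc n) f = ∑Subset n (f ∘ (outside ∷_)) + ∑Subset n (f ∘ (inside ∷_))

∑Subset-cong : ∀ n {f g : Subset n → ℕ} → (∀ A → f A ≡ g A) → ∑Subset n f ≡ ∑Subset n g
∑Subset-cong zero f≗g = f≗g []
∑Subset-cong (suc n) f≗g = cong₂ _+_ (∑Subset-cong n (f≗g ∘ (outside ∷_))) (∑Subset-cong n (f≗g ∘ (inside ∷_)))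

∑Subset-mono : ∀ n {f g : Subset n → ℕ} → (∀ A → f A ≤ g A) → ∑Subset n f ≤ ∑Subset n g
∑Subset-mono zero f≤g = f≤g []
∑Subset-mono (suc n) f≤g = +-mono-≤ (∑Subset-mono n (f≤g ∘ (outside ∷_))) (∑Subset-mono n (f≤g ∘ (inside ∷_)))

∑Subset-distrib-+ : ∀ n (f g : Subset n → ℕ) → ∑Subset n (λ A → f A + g A) ≡ ∑Subset n f + ∑Subset n g
∑Subset-distrib-+ zero f g = refl
∑Subset-distrib-+ (suc n) f g = begin
  ∑Subset n _ + ∑Subset n _                   ≡⟨ cong₂ _+_ (∑Subset-distrib-+ n _ _) (∑Subset-distrib-+ n _ _) ⟩
  (fₒ + gₒ) + (fᵢ + gᵢ)                       ≡⟨ interchange fₒ gₒ fᵢ gᵢ ⟩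
  (fₒ + fᵢ) + (gₒ + gᵢ)                       ∎
  where
  open ≡-Reasoning
  fₒ = ∑Subset n (f ∘ (outside ∷_))
  fᵢ = ∑Subset n (f ∘ (inside ∷_))
  gₒ = ∑Subset n (g ∘ (outside ∷_))
  gᵢ = ∑Subset n (g ∘ (inside ∷_))

*-distribˡ-∑Subset : ∀ n c (f : Subset n → ℕ) → c * ∑Subset n f ≡ ∑Subset n (λ A → c * f A)
*-distribˡ-∑Subset zero c f = refl
*-distribˡ-∑Subset (suc n) c f =
  trans (*-distribˡ-+ c _ _) (cong₂ _+_ (*-distribˡ-∑Subset n c _) (*-distribˡ-∑Subset n c _))

sum-map-subsets : ∀ n (f : Subset n → ℕ) → sum (map f (subsets n)) ≡ ∑Subset n f
sum-map-subsets zero f = +-identityʳ (f [])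
sum-map-subsets (suc n) f = begin
  sum (map f (map (outside ∷_) (subsets n) ++ map (inside ∷_) (subsets n)))
    ≡⟨ cong sum (map-++ f (map (outside ∷_) (subsets n)) _) ⟩
  sum (map f (map (outside ∷_) (subsets n)) ++ map f (map (inside ∷_) (subsets n)))
    ≡⟨ sum-++ (map f (map (outside ∷_) (subsets n))) _ ⟩
  sum (map f (map (outside ∷_) (subsets n))) + sum (map f (map (inside ∷_) (subsets n)))
    ≡⟨ cong₂ (λ xs ys → sum xs + sum ys) (sym (map-∘ (subsets n))) (sym (map-∘ (subsets n))) ⟩
  sum (map (f ∘ (outside ∷_)) (subsets n)) + sum (map (f ∘ (inside ∷_)) (subsets n))
    ≡⟨ cong₂ _+_ (sum-map-subsets n _) (sum-map-subsets n _) ⟩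
  ∑Subset (suc n) f
    ∎
  where open ≡-Reasoning

∑-insertions≡∑-members : ∀ n (w : Subset n → Fin n → ℕ) →
  ∑Subset n (λ B → ∑[ x ∉ B ] w (B [ x ]≔ inside) x) ≡ ∑Subset n (λ A → ∑[ x ∈ A ] w A x)
∑-insertions≡∑-members zero w = refl
-- Terms with x = 0 on the left (B ∌ 0) match those with x = 0 on the right (A ∋ 0);
-- the remaining terms are the identity in dimension n, once for each value of A's 0th coordinate.
∑-insertions≡∑-members (suc n) w = begin
  ∑Subset n (λ B → 1 * new B + Lₒ B) + ∑Subset n Lᵢ   ≡⟨ cong (_+ ∑Subset n Lᵢ) (∑Subset-distrib-+ n _ Lₒ) ⟩
  (X + ∑Subset n Lₒ) + ∑Subset n Lᵢ                    ≡⟨ cong₂ (λ l r → (X + l) + r) (∑-insertions≡∑-members n wₒ)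
                                                                                        (∑-insertions≡∑-members n wᵢ) ⟩
  (X + ∑Subset n Rₒ) + ∑Subset n Rᵢ                    ≡⟨ +-assoc X (∑Subset n Rₒ) (∑Subset n Rᵢ) ⟩
  X + (∑Subset n Rₒ + ∑Subset n Rᵢ)                    ≡⟨ m+[n+o]≡n+[m+o] X (∑Subset n Rₒ) (∑Subset n Rᵢ) ⟩
  ∑Subset n Rₒ + (X + ∑Subset n Rᵢ)                    ≡⟨ cong (∑Subset n Rₒ +_) (∑Subset-distrib-+ n _ Rᵢ) ⟨
  ∑Subset n Rₒ + ∑Subset n (λ A → 1 * new A + Rᵢ A)    ∎
  where
  open ≡-Reasoning
  new : Subset n → ℕ
  new A = w (inside ∷ A) zero
  X : ℕ
  X = ∑Subset n (λ A → 1 * new A)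
  wₒ wᵢ : Subset n → Fin n → ℕ
  wₒ A x = w (outside ∷ A) (suc x)
  wᵢ A x = w (inside ∷ A) (suc x)
  Lₒ Lᵢ Rₒ Rᵢ : Subset n → ℕ
  Lₒ B = ∑[ x ∉ B ] wₒ (B [ x ]≔ inside) x
  Lᵢ B = ∑[ x ∉ B ] wᵢ (B [ x ]≔ inside) x
  Rₒ A = ∑[ x ∈ A ] wₒ A x
  Rᵢ A = ∑[ x ∈ A ] wᵢ A x

∑ofSize : ∀ {n} → ℕ → (Subset n → ℕ) → ℕ
∑ofSize {n} k f = ∑Subset n (λ A → ⟦ ∣ A ∣ ≡ᵇ k ⟧ * f A)

∑ofSize-cong : ∀ {n} k {f g : Subset n → ℕ} → (∀ A → ∣ A ∣ ≡ k → f A ≡ g A) → ∑ofSize k f ≡ ∑ofSize k g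
∑ofSize-cong {n} k f≗g = ∑Subset-cong n pointwise
  where
  pointwise : ∀ A → ⟦ ∣ A ∣ ≡ᵇ k ⟧ * _ ≡ ⟦ ∣ A ∣ ≡ᵇ k ⟧ * _
  pointwise A with ∣ A ∣ ≡ᵇ k in eq
  ... | false = refl
  ... | true = cong (1 *_) (f≗g A (≡ᵇ⇒≡ ∣ A ∣ k (from T-≡ eq)))

∑ofSize-mono : ∀ {n} k {f g : Subset n → ℕ} → (∀ A → f A ≤ g A) → ∑ofSize k f ≤ ∑ofSize k g
∑ofSize-mono {n} k f≤g = ∑Subset-mono n (λ A → *-monoʳ-≤ ⟦ ∣ A ∣ ≡ᵇ k ⟧ (f≤g A))

*-distribˡ-∑ofSize : ∀ {n} k c (f : Subset n → ℕ) → c * ∑ofSize k f ≡ ∑ofSize k (λ A → c * f A)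
*-distribˡ-∑ofSize {n} k c f =
  trans (*-distribˡ-∑Subset n c _) (∑Subset-cong n (λ A → m*[n*o]≡n*[m*o] c ⟦ ∣ A ∣ ≡ᵇ k ⟧ (f A)))

∑ofSize-∑∈ : ∀ {n} k (f : Subset n → ℕ) → ∑ofSize k (λ A → ∑[ x ∈ A ] f A) ≡ k * ∑ofSize k f
∑ofSize-∑∈ k f = trans (∑ofSize-cong k (λ A ∣A∣≡k → trans (∑∈-const A (f A)) (cong (_* f A) ∣A∣≡k)))
                       (sym (*-distribˡ-∑ofSize k k f))

∑ofSize-insertions≡∑ofSize-members : ∀ {n} k (w : Subset n → Fin n → ℕ) →
  ∑ofSize k (λ B → ∑[ x ∉ B ] w (B [ x ]≔ inside) x) ≡ ∑ofSize (suc k) (λ A → ∑[ x ∈ A ] w A x)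
∑ofSize-insertions≡∑ofSize-members {n} k w = begin
  ∑ofSize k (λ B → ∑[ x ∉ B ] w (B [ x ]≔ inside) x)       ≡⟨ ∑Subset-cong n sizeIntoInsertions ⟩
  ∑Subset n (λ B → ∑[ x ∉ B ] w′ (B [ x ]≔ inside) x)      ≡⟨ ∑-insertions≡∑-members n w′ ⟩
  ∑Subset n (λ A → ∑[ x ∈ A ] w′ A x)                      ≡⟨ ∑Subset-cong n sizeIntoMembers ⟨
  ∑ofSize (suc k) (λ A → ∑[ x ∈ A ] w A x)                 ∎
  where
  open ≡-Reasoning
  w′ : Subset n → Fin n → ℕ
  w′ A x = ⟦ ∣ A ∣ ≡ᵇ suc k ⟧ * w A x

  sizeIntoInsertions : ∀ B → ⟦ ∣ B ∣ ≡ᵇ k ⟧ * ∑[ x ∉ B ] w (B [ x ]≔ inside) x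
                           ≡ ∑[ x ∉ B ] w′ (B [ x ]≔ inside) x
  sizeIntoInsertions B = trans (*-distribˡ-sum ⟦ ∣ B ∣ ≡ᵇ k ⟧ (λ x → ⟦ not (lookup B x) ⟧ * w (B [ x ]≔ inside) x))
                               (sum-cong-≗ pointwise)
    where
    pointwise : ∀ x → ⟦ ∣ B ∣ ≡ᵇ k ⟧ * (⟦ not (lookup B x) ⟧ * w (B [ x ]≔ inside) x)
                    ≡ ⟦ not (lookup B x) ⟧ * w′ (B [ x ]≔ inside) x
    pointwise x with lookup B x in x∉B
    ... | inside = *-zeroʳ ⟦ ∣ B ∣ ≡ᵇ k ⟧
    ... | outside = trans (m*[n*o]≡n*[m*o] ⟦ ∣ B ∣ ≡ᵇ k ⟧ 1 _)
                          (cong (λ s → 1 * (⟦ s ≡ᵇ suc k ⟧ * w (B [ x ]≔ inside) x)) (sym (∣insert∣ B x∉B)))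

  sizeIntoMembers : ∀ A → ⟦ ∣ A ∣ ≡ᵇ suc k ⟧ * ∑[ x ∈ A ] w A x ≡ ∑[ x ∈ A ] w′ A x
  sizeIntoMembers A = trans (*-distribˡ-sum ⟦ ∣ A ∣ ≡ᵇ suc k ⟧ (λ x → ⟦ lookup A x ⟧ * w A x))
                            (sum-cong-≗ (λ x → m*[n*o]≡n*[m*o] ⟦ ∣ A ∣ ≡ᵇ suc k ⟧ ⟦ lookup A x ⟧ (w A x)))

[m+d]%n≡m%n⇒n∣d : ∀ m d {n} .{{_ : NonZero n}} → (m + d) % n ≡ m % n → n ∣ d
[m+d]%n≡m%n⇒n∣d m d {n} eq = ∣m+n∣m⇒∣n (subst (n ∣_) quotients (n∣m*n ((m + d) / n))) (n∣m*n (m / n))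
  where
  open ≡-Reasoning
  quotients : (m + d) / n * n ≡ m / n * n + d
  quotients = +-cancelˡ-≡ (m % n) _ _ (begin
    m % n + (m + d) / n * n          ≡⟨ cong (_+ (m + d) / n * n) eq ⟨
    (m + d) % n + (m + d) / n * n    ≡⟨ m≡m%n+[m/n]*n (m + d) n ⟨
    m + d                            ≡⟨ cong (_+ d) (m≡m%n+[m/n]*n m n) ⟩
    m % n + m / n * n + d            ≡⟨ +-assoc (m % n) _ d ⟩
    m % n + (m / n * n + d)          ∎)

n∣d∧d<n⇒d≡0 : ∀ {n d} → n ∣ d → d < n → d ≡ 0
n∣d∧d<n⇒d≡0 {d = zero} _ _ = refl
n∣d∧d<n⇒d≡0 {d = suc _} n∣d d<n = contradiction n∣d (>⇒∤ d<n)

+-cancelˡ-%-≤ : ∀ m {x y n} .{{_ : NonZero n}} → x ≤ y → y < n → (m + x) % n ≡ (m + y) % n → x ≡ y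
+-cancelˡ-%-≤ m {x} {y} {n} x≤y y<n eq = begin
  x                ≡⟨ +-identityʳ x ⟨
  x + 0            ≡⟨ cong (x +_) gap≡0 ⟨
  x + (y ∸ x)      ≡⟨ m+[n∸m]≡n x≤y ⟩
  y                ∎
  where
  open ≡-Reasoning
  y≡x+gap : m + y ≡ (m + x) + (y ∸ x)
  y≡x+gap = trans (cong (m +_) (sym (m+[n∸m]≡n x≤y))) (sym (+-assoc m x (y ∸ x)))
  gap≡0 : y ∸ x ≡ 0
  gap≡0 = n∣d∧d<n⇒d≡0 ([m+d]%n≡m%n⇒n∣d (m + x) (y ∸ x) (trans (cong (_% n) (sym y≡x+gap)) (sym eq)))
                      (≤-<-trans (m∸n≤m y x) y<n)

+-cancelˡ-% : ∀ m {x y n} .{{_ : NonZero n}} → x < n → y < n → (m + x) % n ≡ (m + y) % n → x ≡ y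
+-cancelˡ-% m {x} {y} x<n y<n eq with ≤-total x y
... | inj₁ x≤y = +-cancelˡ-%-≤ m x≤y y<n eq
... | inj₂ y≤x = sym (+-cancelˡ-%-≤ m y≤x x<n (sym eq))

%-cancel-+ : ∀ {m o x y n} .{{_ : NonZero n}} → m % n ≡ o % n → m + x ≡ o + y → x < n → y < n → x ≡ y
%-cancel-+ {m} {o} {x} {y} {n} m≡o m+x≡o+y x<n y<n = +-cancelˡ-% m x<n y<n (begin
  (m + x) % n                  ≡⟨ cong (_% n) m+x≡o+y ⟩
  (o + y) % n                  ≡⟨ %-distribˡ-+ o y n ⟩
  (o % n + y % n) % n          ≡⟨ cong (λ r → (r + y % n) % n) m≡o ⟨
  (m % n + y % n) % n          ≡⟨ %-distribˡ-+ m y n ⟨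
  (m + y) % n                  ∎)
  where open ≡-Reasoning

does-∈? : ∀ {n} (x : Fin n) (A : Subset n) → does (x ∈? A) ≡ lookup A x
does-∈? zero (inside ∷ A) = refl
does-∈? zero (outside ∷ A) = refl
does-∈? (suc x) (_ ∷ A) = does-∈? x A

module _ {a p} {X : Set a} {P : Pred X p} (P? : Decidable P) where

  length-filter≡sum : ∀ xs → length (filter P? xs) ≡ sum (map (λ x → ⟦ does (P? x) ⟧) xs)
  length-filter≡sum [] = refl
  length-filter≡sum (x ∷ xs) with does (P? x)
  ... | true = cong suc (length-filter≡sum xs)
  ... | false = length-filter≡sum xs

  sum-map-filter : ∀ (f : X → ℕ) xs → sum (map f (filter P? xs)) ≡ sum (map (λ x → ⟦ does (P? x) ⟧ * f x) xs)
  sum-map-filter f [] = refl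
  sum-map-filter f (x ∷ xs) with does (P? x)
  ... | true = cong₂ _+_ (sym (*-identityˡ (f x))) (sum-map-filter f xs)
  ... | false = sum-map-filter f xs

length-filter-subsets : ∀ n {p} {P : Pred (Subset n) p} (P? : Decidable P) →
                        length (filter P? (subsets n)) ≡ ∑Subset n (λ A → ⟦ does (P? A) ⟧)
length-filter-subsets n P? = trans (length-filter≡sum P? (subsets n)) (sum-map-subsets n _)

sum-tabulate : ∀ {n} (f : Fin n → ℕ) → sum (tabulate f) ≡ ∑[ i < n ] f i
sum-tabulate {zero} f = refl
sum-tabulate {suc n} f = cong (f zero +_) (sum-tabulate (f ∘ suc))

elemSum≡∑∈ : ∀ {n} (A : Subset n) → elemSum A ≡ ∑[ x ∈ A ] toℕ x
elemSum≡∑∈ {n} A = begin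
  sum (map toℕ (filter (_∈? A) (allFin n)))   ≡⟨ sum-map-filter (_∈? A) toℕ (allFin n) ⟩
  sum (map f (allFin n))                      ≡⟨ cong sum (map-tabulate id f) ⟩
  sum (tabulate f)                            ≡⟨ sum-tabulate f ⟩
  ∑[ x < n ] f x                              ≡⟨ sum-cong-≗ (λ x → cong (λ b → ⟦ b ⟧ * toℕ x) (does-∈? x A)) ⟩
  ∑[ x ∈ A ] toℕ x                            ∎
  where
  open ≡-Reasoning
  f : Fin n → ℕ
  f x = ⟦ does (x ∈? A) ⟧ * toℕ x

elemSum-insert : ∀ {n} (A : Subset n) {x} → lookup A x ≡ outside → elemSum (A [ x ]≔ inside) ≡ elemSum A + toℕ x
elemSum-insert A {x} x∉A = begin
  elemSum (A [ x ]≔ inside)          ≡⟨ elemSum≡∑∈ (A [ x ]≔ inside) ⟩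
  ∑[ y ∈ A [ x ]≔ inside ] toℕ y     ≡⟨ ∑∈-insert A toℕ x∉A ⟩
  toℕ x + ∑[ y ∈ A ] toℕ y           ≡⟨ +-comm (toℕ x) _ ⟩
  ∑[ y ∈ A ] toℕ y + toℕ x           ≡⟨ cong (_+ toℕ x) (elemSum≡∑∈ A) ⟨
  elemSum A + toℕ x                  ∎
  where open ≡-Reasoning

elemSum-remove : ∀ {n} (A : Subset n) {x} → lookup A x ≡ inside → elemSum (A [ x ]≔ outside) + toℕ x ≡ elemSum A
elemSum-remove A {x} x∈A = begin
  elemSum (A [ x ]≔ outside) + toℕ x                ≡⟨ elemSum-insert (A [ x ]≔ outside) (lookup∘update x A outside) ⟨
  elemSum ((A [ x ]≔ outside) [ x ]≔ inside)        ≡⟨ cong elemSum (update-restore A outside x∈A) ⟩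
  elemSum A                                         ∎
  where open ≡-Reasoning

insertion-unique : ∀ {n} .{{_ : NonZero n}} (A : Subset n) {x y} → lookup A x ≡ outside → lookup A y ≡ outside →
                   elemSum (A [ x ]≔ inside) % n ≡ elemSum (A [ y ]≔ inside) % n → x ≡ y
insertion-unique {n} A {x} {y} x∉A y∉A eq = toℕ-injective (+-cancelˡ-% (elemSum A) (toℕ<n x) (toℕ<n y)
  (subst₂ (λ s s′ → s % n ≡ s′ % n) (elemSum-insert A x∉A) (elemSum-insert A y∉A) eq))

removal-unique : ∀ {n} .{{_ : NonZero n}} (A : Subset n) {x y} → lookup A x ≡ inside → lookup A y ≡ inside →
                 elemSum (A [ x ]≔ outside) % n ≡ elemSum (A [ y ]≔ outside) % n → x ≡ y
removal-unique A {x} {y} x∈A y∈A eq = toℕ-injective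
  (%-cancel-+ eq (trans (elemSum-remove A x∈A) (sym (elemSum-remove A y∈A))) (toℕ<n x) (toℕ<n y))

≤-transfer : ∀ a b {x y z} .{{_ : NonZero a}} → a * x ≤ z → a * y ≡ b * z → b * x ≤ y
≤-transfer a b {x} {y} {z} ax≤z ay≡bz = *-cancelˡ-≤ a (begin
  a * (b * x)    ≡⟨ m*[n*o]≡n*[m*o] a b x ⟩
  b * (a * x)    ≤⟨ *-monoʳ-≤ b ax≤z ⟩
  b * z          ≡⟨ ay≡bz ⟨
  a * y          ∎)
  where open ≤-Reasoning

1+m≤[m∸k]+[2+k] : ∀ {m k} → k ≤ m → suc m ≤ (m ∸ k) + suc (suc k)
1+m≤[m∸k]+[2+k] {m} {k} k≤m = ≤-trans (n≤1+n (suc m)) (≤-reflexive (sym (begin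
  (m ∸ k) + suc (suc k)    ≡⟨ +-comm (m ∸ k) _ ⟩
  suc (suc (k + (m ∸ k)))  ≡⟨ cong (λ s → suc (suc s)) (m+[n∸m]≡n k≤m) ⟩
  suc (suc m)              ∎)))
  where open ≡-Reasoning

-- ℤₙ is Fin (suc m), so m = n − 1 is the number of nonzero residues.
module Counting (m : ℕ) (t : Fin (suc m)) where

  excludes0 : Subset (suc m) → Bool
  excludes0 A = not (lookup A zero)

  sum≡t : Subset (suc m) → Bool
  sum≡t A = elemSum A % suc m ≡ᵇ toℕ t

  isGood : Subset (suc m) → Bool
  isGood A = excludes0 A ∧ sum≡t A

  #nonzero #good : ℕ → ℕ
  #nonzero k = ∑ofSize k (λ A → ⟦ excludes0 A ⟧)
  #good k = ∑ofSize k (λ A → ⟦ isGood A ⟧)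

  sum≡t⇒ : ∀ A → T (sum≡t A) → elemSum A % suc m ≡ toℕ t
  sum≡t⇒ A = ≡ᵇ⇒≡ _ _

  ∑∉-excludes0 : ∀ B → ∑[ x ∉ B ] ⟦ excludes0 (B [ x ]≔ inside) ⟧ ≡ ⟦ excludes0 B ⟧ * (m ∸ ∣ B ∣)
  ∑∉-excludes0 (inside ∷ B) = ∑-zero (λ x → ⟦ not (lookup (inside ∷ B) x) ⟧ * ⟦ excludes0 ((inside ∷ B) [ x ]≔ inside) ⟧)
    λ { zero → refl ; (suc x) → *-zeroʳ ⟦ not (lookup B x) ⟧ }
  ∑∉-excludes0 (outside ∷ B) = trans (∑∉-const B 1) (*-comm (m ∸ ∣ B ∣) 1)

  ∑∉-isGood≤ : ∀ B → ∑[ x ∉ B ] ⟦ isGood (B [ x ]≔ inside) ⟧ ≤ ⟦ excludes0 B ⟧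
  ∑∉-isGood≤ (inside ∷ B) = ≤-reflexive (∑-zero (λ x → ⟦ not (lookup (inside ∷ B) x) ⟧ * ⟦ isGood ((inside ∷ B) [ x ]≔ inside) ⟧)
    λ { zero → refl ; (suc x) → *-zeroʳ ⟦ not (lookup B x) ⟧ })
  ∑∉-isGood≤ B@(outside ∷ _) =
    ≤-trans (≤-reflexive (sum-cong-≗ (λ x → sym (⟦∧⟧ (not (lookup B x)) (isGood (B [ x ]≔ inside))))))
            (∑⟦⟧≤1 (λ x → not (lookup B x) ∧ isGood (B [ x ]≔ inside)) unique)
    where
    unique : ∀ {x y} → T (not (lookup B x) ∧ isGood (B [ x ]≔ inside)) →
                       T (not (lookup B y) ∧ isGood (B [ y ]≔ inside)) → x ≡ y
    unique {x} {y} px py with to T-∧ px | to T-∧ py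
    ... | x∉B , goodx | y∉B , goody = insertion-unique B (to T-not-≡ x∉B) (to T-not-≡ y∉B)
      (trans (sum≡t⇒ (B [ x ]≔ inside) (proj₂ (to T-∧ goodx)))
             (sym (sum≡t⇒ (B [ y ]≔ inside) (proj₂ (to T-∧ goody)))))

  ∑∈-removal-sum≡t≤ : ∀ A → ∑[ x ∈ A ] ⟦ excludes0 A ∧ sum≡t (A [ x ]≔ outside) ⟧ ≤ ⟦ excludes0 A ⟧
  ∑∈-removal-sum≡t≤ (inside ∷ A) = ≤-reflexive
    (∑-zero (λ x → ⟦ lookup (inside ∷ A) x ⟧ * 0) (λ x → *-zeroʳ ⟦ lookup (inside ∷ A) x ⟧))
  ∑∈-removal-sum≡t≤ A@(outside ∷ _) =
    ≤-trans (≤-reflexive (sum-cong-≗ (λ x → sym (⟦∧⟧ (lookup A x) (sum≡t (A [ x ]≔ outside))))))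
            (∑⟦⟧≤1 (λ x → lookup A x ∧ sum≡t (A [ x ]≔ outside)) unique)
    where
    unique : ∀ {x y} → T (lookup A x ∧ sum≡t (A [ x ]≔ outside)) →
                       T (lookup A y ∧ sum≡t (A [ y ]≔ outside)) → x ≡ y
    unique {x} {y} px py with to T-∧ px | to T-∧ py
    ... | x∈A , sumx | y∈A , sumy = removal-unique A (to T-≡ x∈A) (to T-≡ y∈A)
      (trans (sum≡t⇒ (A [ x ]≔ outside) sumx) (sym (sum≡t⇒ (A [ y ]≔ outside) sumy)))

  ∑∉-insert-remove : ∀ B → ∑[ x ∉ B ] ⟦ excludes0 (B [ x ]≔ inside) ∧ sum≡t ((B [ x ]≔ inside) [ x ]≔ outside) ⟧
                           ≡ (m ∸ ∣ B ∣) * ⟦ isGood B ⟧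
  ∑∉-insert-remove B = begin
    ∑[ x ∉ B ] ⟦ excludes0 (B [ x ]≔ inside) ∧ sum≡t ((B [ x ]≔ inside) [ x ]≔ outside) ⟧
      ≡⟨ sum-cong-≗ pointwise ⟩
    ∑[ x < suc m ] (⟦ not (lookup B x) ⟧ * ⟦ excludes0 (B [ x ]≔ inside) ⟧ * ⟦ sum≡t B ⟧)
      ≡⟨ *-distribʳ-sum ⟦ sum≡t B ⟧ (λ x → ⟦ not (lookup B x) ⟧ * ⟦ excludes0 (B [ x ]≔ inside) ⟧) ⟨
    ∑[ x ∉ B ] ⟦ excludes0 (B [ x ]≔ inside) ⟧ * ⟦ sum≡t B ⟧
      ≡⟨ cong (_* ⟦ sum≡t B ⟧) (∑∉-excludes0 B) ⟩
    ⟦ excludes0 B ⟧ * (m ∸ ∣ B ∣) * ⟦ sum≡t B ⟧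
      ≡⟨ m*n*o≡n*[m*o] ⟦ excludes0 B ⟧ (m ∸ ∣ B ∣) ⟦ sum≡t B ⟧ ⟩
    (m ∸ ∣ B ∣) * (⟦ excludes0 B ⟧ * ⟦ sum≡t B ⟧)
      ≡⟨ cong ((m ∸ ∣ B ∣) *_) (⟦∧⟧ (excludes0 B) (sum≡t B)) ⟨
    (m ∸ ∣ B ∣) * ⟦ isGood B ⟧
      ∎
    where
    open ≡-Reasoning
    pointwise : ∀ x → ⟦ not (lookup B x) ⟧ * ⟦ excludes0 (B [ x ]≔ inside) ∧ sum≡t ((B [ x ]≔ inside) [ x ]≔ outside) ⟧
                    ≡ ⟦ not (lookup B x) ⟧ * ⟦ excludes0 (B [ x ]≔ inside) ⟧ * ⟦ sum≡t B ⟧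
    pointwise x with lookup B x in x∉B
    ... | inside = refl
    ... | outside = begin
      1 * ⟦ excludes0 (B [ x ]≔ inside) ∧ sum≡t ((B [ x ]≔ inside) [ x ]≔ outside) ⟧
        ≡⟨ cong (λ A → 1 * ⟦ excludes0 (B [ x ]≔ inside) ∧ sum≡t A ⟧) (update-restore B inside x∉B) ⟩
      1 * ⟦ excludes0 (B [ x ]≔ inside) ∧ sum≡t B ⟧
        ≡⟨ cong (1 *_) (⟦∧⟧ (excludes0 (B [ x ]≔ inside)) (sum≡t B)) ⟩
      1 * (⟦ excludes0 (B [ x ]≔ inside) ⟧ * ⟦ sum≡t B ⟧)
        ≡⟨ *-assoc 1 ⟦ excludes0 (B [ x ]≔ inside) ⟧ ⟦ sum≡t B ⟧ ⟨
      1 * ⟦ excludes0 (B [ x ]≔ inside) ⟧ * ⟦ sum≡t B ⟧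
        ∎

  #good-deletion-bound : ∀ k → suc k * #good (suc k) ≤ #nonzero k
  #good-deletion-bound k = begin
    suc k * #good (suc k)                                       ≡⟨ ∑ofSize-∑∈ (suc k) (λ A → ⟦ isGood A ⟧) ⟨
    ∑ofSize (suc k) (λ A → ∑[ x ∈ A ] ⟦ isGood A ⟧)             ≡⟨ ∑ofSize-insertions≡∑ofSize-members k (λ A _ → ⟦ isGood A ⟧) ⟨
    ∑ofSize k (λ B → ∑[ x ∉ B ] ⟦ isGood (B [ x ]≔ inside) ⟧)   ≤⟨ ∑ofSize-mono k ∑∉-isGood≤ ⟩
    #nonzero k                                                  ∎
    where open ≤-Reasoning

  #nonzero-recurrence : ∀ k → suc k * #nonzero (suc k) ≡ (m ∸ k) * #nonzero k
  #nonzero-recurrence k = begin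
    suc k * #nonzero (suc k)                                       ≡⟨ ∑ofSize-∑∈ (suc k) (λ A → ⟦ excludes0 A ⟧) ⟨
    ∑ofSize (suc k) (λ A → ∑[ x ∈ A ] ⟦ excludes0 A ⟧)             ≡⟨ ∑ofSize-insertions≡∑ofSize-members k (λ A _ → ⟦ excludes0 A ⟧) ⟨
    ∑ofSize k (λ B → ∑[ x ∉ B ] ⟦ excludes0 (B [ x ]≔ inside) ⟧)   ≡⟨ ∑ofSize-cong k step ⟩
    ∑ofSize k (λ B → (m ∸ k) * ⟦ excludes0 B ⟧)                    ≡⟨ *-distribˡ-∑ofSize k (m ∸ k) (λ A → ⟦ excludes0 A ⟧) ⟨
    (m ∸ k) * #nonzero k                                           ∎
    where
    open ≡-Reasoning
    step : ∀ B → ∣ B ∣ ≡ k → ∑[ x ∉ B ] ⟦ excludes0 (B [ x ]≔ inside) ⟧ ≡ (m ∸ k) * ⟦ excludes0 B ⟧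
    step B ∣B∣≡k = trans (∑∉-excludes0 B) (trans (*-comm ⟦ excludes0 B ⟧ (m ∸ ∣ B ∣))
                                                 (cong (λ s → (m ∸ s) * ⟦ excludes0 B ⟧) ∣B∣≡k))

  #good-insertion-bound : ∀ ℓ → (m ∸ ℓ) * #good ℓ ≤ #nonzero (suc ℓ)
  #good-insertion-bound ℓ = begin
    (m ∸ ℓ) * #good ℓ
      ≡⟨ *-distribˡ-∑ofSize ℓ (m ∸ ℓ) (λ A → ⟦ isGood A ⟧) ⟩
    ∑ofSize ℓ (λ B → (m ∸ ℓ) * ⟦ isGood B ⟧)
      ≡⟨ ∑ofSize-cong ℓ (λ B ∣B∣≡ℓ → trans (∑∉-insert-remove B) (cong (λ s → (m ∸ s) * ⟦ isGood B ⟧) ∣B∣≡ℓ)) ⟨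
    ∑ofSize ℓ (λ B → ∑[ x ∉ B ] w (B [ x ]≔ inside) x)
      ≡⟨ ∑ofSize-insertions≡∑ofSize-members ℓ w ⟩
    ∑ofSize (suc ℓ) (λ A → ∑[ x ∈ A ] w A x)
      ≤⟨ ∑ofSize-mono (suc ℓ) ∑∈-removal-sum≡t≤ ⟩
    #nonzero (suc ℓ)
      ∎
    where
    open ≤-Reasoning
    w : Subset (suc m) → Fin (suc m) → ℕ
    w A x = ⟦ excludes0 A ∧ sum≡t (A [ x ]≔ outside) ⟧

  n*#good≤2*#nonzero : ∀ k → suc k < m → suc m * #good (suc k) ≤ 2 * #nonzero (suc k)
  n*#good≤2*#nonzero k 1+k<m = begin
    suc m * N                          ≤⟨ *-monoˡ-≤ N (1+m≤[m∸k]+[2+k] (<⇒≤ (<-trans (n<1+n k) 1+k<m))) ⟩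
    ((m ∸ k) + suc (suc k)) * N        ≡⟨ *-distribʳ-+ N (m ∸ k) (suc (suc k)) ⟩
    (m ∸ k) * N + suc (suc k) * N      ≤⟨ +-mono-≤ below above ⟩
    C + C                              ≡⟨ cong (C +_) (+-identityʳ C) ⟨
    2 * C                              ∎
    where
    open ≤-Reasoning
    N C : ℕ
    N = #good (suc k)
    C = #nonzero (suc k)
    below : (m ∸ k) * N ≤ C
    below = ≤-transfer (suc k) (m ∸ k) (#good-deletion-bound k) (#nonzero-recurrence k)
    above : suc (suc k) * N ≤ C
    above = ≤-transfer (m ∸ suc k) (suc (suc k)) {{>-nonZero (m<n⇒0<n∸m 1+k<m)}}
                       (#good-insertion-bound (suc k)) (sym (#nonzero-recurrence (suc k)))

  total≡#nonzero : ∀ ℓ → total (suc m) ℓ ≡ #nonzero ℓ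
  total≡#nonzero ℓ = trans (length-filter-subsets (suc m) (isLSubset (suc m) ℓ)) (∑Subset-cong (suc m) pointwise)
    where
    pointwise : ∀ A → ⟦ not (does (zero ∈? A)) ∧ (∣ A ∣ ≡ᵇ ℓ) ⟧ ≡ ⟦ ∣ A ∣ ≡ᵇ ℓ ⟧ * ⟦ excludes0 A ⟧
    pointwise A = begin
      ⟦ not (does (zero ∈? A)) ∧ (∣ A ∣ ≡ᵇ ℓ) ⟧    ≡⟨ cong (λ b → ⟦ not b ∧ (∣ A ∣ ≡ᵇ ℓ) ⟧) (does-∈? zero A) ⟩
      ⟦ excludes0 A ∧ (∣ A ∣ ≡ᵇ ℓ) ⟧               ≡⟨ ⟦∧⟧ (excludes0 A) (∣ A ∣ ≡ᵇ ℓ) ⟩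
      ⟦ excludes0 A ⟧ * ⟦ ∣ A ∣ ≡ᵇ ℓ ⟧             ≡⟨ *-comm ⟦ excludes0 A ⟧ _ ⟩
      ⟦ ∣ A ∣ ≡ᵇ ℓ ⟧ * ⟦ excludes0 A ⟧             ∎
      where open ≡-Reasoning

  good≡#good : ∀ ℓ → good (suc m) ℓ t ≡ #good ℓ
  good≡#good ℓ = trans (length-filter-subsets (suc m) _) (∑Subset-cong (suc m) pointwise)
    where
    pointwise : ∀ A → ⟦ (not (does (zero ∈? A)) ∧ (∣ A ∣ ≡ᵇ ℓ)) ∧ sum≡t A ⟧ ≡ ⟦ ∣ A ∣ ≡ᵇ ℓ ⟧ * ⟦ isGood A ⟧
    pointwise A = begin
      ⟦ (not (does (zero ∈? A)) ∧ (∣ A ∣ ≡ᵇ ℓ)) ∧ sum≡t A ⟧   ≡⟨ cong (λ b → ⟦ (not b ∧ (∣ A ∣ ≡ᵇ ℓ)) ∧ sum≡t A ⟧) (does-∈? zero A) ⟩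
      ⟦ (excludes0 A ∧ (∣ A ∣ ≡ᵇ ℓ)) ∧ sum≡t A ⟧              ≡⟨ cong ⟦_⟧ (xy∙z≈y∙xz (excludes0 A) (∣ A ∣ ≡ᵇ ℓ) (sum≡t A)) ⟩
      ⟦ (∣ A ∣ ≡ᵇ ℓ) ∧ isGood A ⟧                             ≡⟨ ⟦∧⟧ (∣ A ∣ ≡ᵇ ℓ) (isGood A) ⟩
      ⟦ ∣ A ∣ ≡ᵇ ℓ ⟧ * ⟦ isGood A ⟧                           ∎
      where open ≡-Reasoning

lemma1 : ∀ (n : ℕ) .{{_ : NonZero n}} (ℓ : ℕ) (t : Fin n) → 1 ≤ ℓ → ℓ ≤ n ∸ 2 → n * good n ℓ t ≤ 2 * total n ℓ
lemma1 n zero t () _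
lemma1 zero (suc k) t _ ()
lemma1 (suc zero) (suc k) t _ ()
lemma1 (suc (suc m)) (suc k) t _ ℓ≤n∸2 =
  subst₂ (λ g z → suc (suc m) * g ≤ 2 * z) (sym (good≡#good (suc k))) (sym (total≡#nonzero (suc k)))
         (n*#good≤2*#nonzero k (s≤s ℓ≤n∸2))
  where open Counting (suc m) t
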